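{- For any $n\geq 1$, $R_n$ listed in Reflected Gray Code Order $\prec$ and $R_n$ listed in co-Reflected Gray Code Order $\lessdot$ are both $3$-adjacent Gray codes.
   Context: A restricted growth function of length $n$ is an integer sequence $s_1s_2\ldots s_n$ with $s_1=0$ and $0\leq s_{i+1}\leq \max\{s_j\}_{j=1}^i+1$ for all $1\leq i\leq n-1$; $R_n$ denotes the set of these. On $\{0,1,\ldots,m-1\}^n$ ($m\geq 2$), for sequences $\mathbf{s}=s_1\ldots s_n$, $\mathbf{t}=t_1\ldots t_n$ with leftmost differing position $k$: the Reflected Gray Code Order has $\mathbf{s}\prec\mathbf{t}$ if either $\sum_{i=1}^{k-1}s_i$ is even and $s_k<t_k$, or $\sum_{i=1}^{k-1}s_i$ is odd and $s_k>t_k$; the co-Reflected Gray Code Order has $\mathbf{s}\lessdot\mathbf{t}$ if either $U_k$ is even and $s_k<t_k$, or $U_k$ is odd and $s_k>t_k$, where $U_k=|\{i\in\{1,\ldots,k-1\}: s_i\neq 0,\ s_i \text{ even}\}|$. A list of same-length sequences is a $d$-adjacent Gray code if consecutive sequences differ in at most $d$ positions and these positions are adjacent. -}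

module Defs where

open import Data.Nat using (ℕ; zero; suc; _+_; _≤_; _<_; _⊔_; _%_)
open import Data.Fin using (Fin; toℕ)
open import Data.Vec using (Vec; []; _∷_; lookup)
open import Data.List using (List)
open import Data.List.Membership.Propositional using (_∈_)
open import Data.List.Relation.Unary.Linked using (Linked)
open import Data.Product using (_×_; ∃₂)
open import Data.Sum using (_⊎_)
open import Data.Unit using (⊤)
open import Data.Empty using (⊥)
open import Relation.Binary.PropositionalEquality using (_≡_; _≢_)
open import Function.Bundles using (_⇔_)

-- Restricted growth functions, written as Vec ℕ n (s₁ … sₙ).
-- RGFTail m xs : every entry is ≤ (current maximum of the prefix) + 1,
-- where m is the maximum of the prefix read so far.
RGFTail : {n : ℕ} → ℕ → Vec ℕ n → Set
RGFTail m []       = ⊤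
RGFTail m (x ∷ xs) = x ≤ suc m × RGFTail (m ⊔ x) xs

IsRGF : {n : ℕ} → Vec ℕ n → Set
IsRGF []       = ⊤
IsRGF (x ∷ xs) = x ≡ 0 × RGFTail x xs

-- The parameter a is the
-- value of a statistic of the common prefix s₁…s_{k-1}; 'step' updates it
-- by one more entry.
ReflLex : (ℕ → ℕ → ℕ) → ℕ → {n : ℕ} → Vec ℕ n → Vec ℕ n → Set
ReflLex step a []       []       = ⊥
ReflLex step a (x ∷ xs) (y ∷ ys) =
  (x ≡ y × ReflLex step (step a x) xs ys)
  ⊎ (x ≢ y × ((a % 2 ≡ 0 × x < y) ⊎ (a % 2 ≡ 1 × y < x)))

sumStep : ℕ → ℕ → ℕ
sumStep a x = a + x

nzEvenStep : ℕ → ℕ → ℕ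
nzEvenStep a zero    = a
nzEvenStep a (suc x) with suc x % 2
... | zero  = suc a
... | suc _ = a

_≺_ : {n : ℕ} → Vec ℕ n → Vec ℕ n → Set
s ≺ t = ReflLex sumStep 0 s t

_⋖_ : {n : ℕ} → Vec ℕ n → Vec ℕ n → Set
s ⋖ t = ReflLex nzEvenStep 0 s t

Adjacent : ℕ → {n : ℕ} → Vec ℕ n → Vec ℕ n → Set
Adjacent d {n} s t =
  ∃₂ λ a b → (b ≤ a + d) ×
    ((i : Fin n) → (lookup s i ≢ lookup t i) ⇔ (a ≤ toℕ i × toℕ i < b))

IsAdjGray : ℕ → {n : ℕ} → List (Vec ℕ n) → Set
IsAdjGray d = Linked (Adjacent d)

IsListingOfRGF : {n : ℕ} → (Vec ℕ n → Vec ℕ n → Set) → List (Vec ℕ n) → Set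
IsListingOfRGF {n} R L = ((s : Vec ℕ n) → (s ∈ L) ⇔ IsRGF s) × Linked R L

module Submission where

-- We work with any 'step' that is a translation
-- (step b y = b + step 0 y, step 0 0 = 0) such that of two consecutive positive
-- entries at least one flips the parity; both statistics of the paper qualify.
-- For such orders, if s precedes t then either a sequence lies strictly
-- between them, or at their first difference k the tail of s is the greatest
-- valid tail (maxTail) and the tail of t the least one (minTail).  Extremal
-- tails all have the shape 0…, (M+1)0… or (M+1)(M+2)0…, and a greatest and a
-- least tail differ exactly on a prefix of length ≤ 2, so s, t differ only in
-- positions k, k+1, k+2.  A strictly increasing listing leaves nothing between
-- consecutive entries, which are therefore 3-adjacent; this holds for every n.

open import Defs
open import Data.Nat using (ℕ; zero; suc; _+_; _*_; _≤_; _<_; _≥_; _⊔_; _%_; z≤n; s≤s)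
open import Data.Nat.Properties
  using (+-assoc; +-comm; +-identityʳ; *-comm; ≤-refl; ≤-trans; <-trans; <⇒≤; <⇒≢; >⇒≢;
         n<1+n; n≤1+n; 0≢1+n; suc-injective; m≤n⇒m<n∨m≡n; m≤n⇒m⊔n≡n; _≟_)
open import Data.Nat.DivMod using (%-distribˡ-+; [m+kn]%n≡m%n)
open import Data.Fin using (Fin; toℕ) renaming (zero to fzero; suc to fsuc)
open import Data.Vec using (Vec; []; _∷_; lookup)
open import Data.List using (List; []; _∷_)
open import Data.List.Membership.Propositional using (_∈_)
open import Data.List.Relation.Unary.Any using (here; there)
open import Data.List.Relation.Unary.All using (All; []; _∷_)
import Data.List.Relation.Unary.All as All
open import Data.List.Relation.Unary.AllPairs using (AllPairs; []; _∷_)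
open import Data.List.Relation.Unary.Linked using (Linked; []; [-]; _∷_)
open import Data.List.Relation.Unary.Linked.Properties using (Linked⇒AllPairs)
open import Data.Product using (_×_; _,_; Σ; proj₂)
open import Data.Sum using (_⊎_; inj₁; inj₂)
import Data.Sum as Sum
open import Data.Unit using (tt)
open import Data.Empty using (⊥-elim)
open import Function using (_∘_)
open import Function.Bundles using (_⇔_; mk⇔; Equivalence)
open import Relation.Nullary using (¬_; yes; no)
open import Relation.Binary.Definitions using (Transitive)
open import Relation.Binary.PropositionalEquality
  using (_≡_; _≢_; refl; sym; trans; cong; subst; ≢-sym; module ≡-Reasoning)
open ≡-Reasoning

parity : ∀ b → b % 2 ≡ 0 ⊎ b % 2 ≡ 1
parity zero          = inj₁ refl
parity (suc zero)    = inj₂ refl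
parity (suc (suc b)) = parity b

opposite-parity : ∀ b c → b % 2 ≢ c % 2 →
                  (b % 2 ≡ 0 × c % 2 ≡ 1) ⊎ (b % 2 ≡ 1 × c % 2 ≡ 0)
opposite-parity b c b≢c with parity b | parity c
... | inj₁ b0 | inj₁ c0 = ⊥-elim (b≢c (trans b0 (sym c0)))
... | inj₁ b0 | inj₂ c1 = inj₁ (b0 , c1)
... | inj₂ b1 | inj₁ c0 = inj₂ (b1 , c0)
... | inj₂ b1 | inj₂ c1 = ⊥-elim (b≢c (trans b1 (sym c1)))

%2-+-congˡ : ∀ b c d → b % 2 ≡ c % 2 → (b + d) % 2 ≡ (c + d) % 2
%2-+-congˡ b c d b≡c = begin
  (b + d) % 2           ≡⟨ %-distribˡ-+ b d 2 ⟩
  (b % 2 + d % 2) % 2   ≡⟨ cong (λ r → (r + d % 2) % 2) b≡c ⟩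
  (c % 2 + d % 2) % 2   ≡⟨ sym (%-distribˡ-+ c d 2) ⟩
  (c + d) % 2           ∎

%2-+-double : ∀ b d → (b + d + d) % 2 ≡ b % 2
%2-+-double b d = begin
  (b + d + d) % 2    ≡⟨ cong (_% 2) (+-assoc b d d) ⟩
  (b + (d + d)) % 2  ≡⟨ cong (λ k → (b + k) % 2) (sym d*2≡d+d) ⟩
  (b + d * 2) % 2    ≡⟨ [m+kn]%n≡m%n b d 2 ⟩
  b % 2              ∎
  where
  d*2≡d+d : d * 2 ≡ d + d
  d*2≡d+d = trans (*-comm d 2) (cong (d +_) (+-identityʳ d))

%2-+-cancelˡ : ∀ b c d → (b + d) % 2 ≡ (c + d) % 2 → b % 2 ≡ c % 2
%2-+-cancelˡ b c d eq = begin
  b % 2            ≡⟨ sym (%2-+-double b d) ⟩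
  (b + d + d) % 2  ≡⟨ %2-+-congˡ (b + d) (c + d) d eq ⟩
  (c + d + d) % 2  ≡⟨ %2-+-double c d ⟩
  c % 2            ∎

odd-+-flips : ∀ b {d} → d % 2 ≡ 1 → (b + d) % 2 ≢ b % 2
odd-+-flips b {d} d-odd eq =
  0≢1+n (trans (sym (%2-+-cancelˡ d 0 b (trans (cong (_% 2) (+-comm d b)) eq))) d-odd)

suc-flips : ∀ b → suc b % 2 ≢ b % 2
suc-flips b eq with %2-+-cancelˡ 1 0 b eq
... | ()

parityCase : {A : Set} → ℕ → A → A → A
parityCase zero    onEven onOdd = onEven
parityCase (suc _) onEven onOdd = onOdd

byParity : {A : Set} → ℕ → A → A → A
byParity a = parityCase (a % 2)

byParity-even : ∀ {A : Set} a {onEven onOdd : A} → a % 2 ≡ 0 → byParity a onEven onOdd ≡ onEven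
byParity-even a {e} {o} a0 = cong (λ r → parityCase r e o) a0

byParity-odd : ∀ {A : Set} a {onEven onOdd : A} → a % 2 ≡ 1 → byParity a onEven onOdd ≡ onOdd
byParity-odd a {e} {o} a1 = cong (λ r → parityCase r e o) a1

data DiffPrefix : ℕ → {n : ℕ} → Vec ℕ n → Vec ℕ n → Set where
  agree  : ∀ {k n} {xs : Vec ℕ n} → DiffPrefix k xs xs
  differ : ∀ {k n x y} {xs ys : Vec ℕ n} →
           x ≢ y → DiffPrefix k xs ys → DiffPrefix (suc k) (x ∷ xs) (y ∷ ys)

DiffPrefix-sym : ∀ {k n} {xs ys : Vec ℕ n} → DiffPrefix k xs ys → DiffPrefix k ys xs
DiffPrefix-sym agree          = agree
DiffPrefix-sym (differ x≢y p) = differ (≢-sym x≢y) (DiffPrefix-sym p)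

diffPrefix-interval : ∀ {k n} {xs ys : Vec ℕ n} → DiffPrefix k xs ys →
  Σ ℕ λ j → j ≤ k × ((i : Fin n) → (lookup xs i ≢ lookup ys i) ⇔ (0 ≤ toℕ i × toℕ i < j))
diffPrefix-interval agree = 0 , z≤n , λ i → mk⇔ (λ ne → ⊥-elim (ne refl)) (λ { (_ , ()) })
diffPrefix-interval {suc k} {suc n} {x ∷ xs} {y ∷ ys} (differ x≢y p)
  with diffPrefix-interval p
... | j , j≤k , tail-diff = suc j , s≤s j≤k , diff
  where
  diff : (i : Fin (suc n)) → (lookup (x ∷ xs) i ≢ lookup (y ∷ ys) i) ⇔ (0 ≤ toℕ i × toℕ i < suc j)
  diff fzero    = mk⇔ (λ _ → z≤n , s≤s z≤n) (λ _ → x≢y)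
  diff (fsuc i) = mk⇔ (λ ne → z≤n , s≤s (proj₂ (Equivalence.to (tail-diff i) ne)))
                      (λ { (_ , s≤s i<j) → Equivalence.from (tail-diff i) (z≤n , i<j) })

DiffPrefix⇒Adjacent : ∀ {k n} {xs ys : Vec ℕ n} → DiffPrefix k xs ys → Adjacent k xs ys
DiffPrefix⇒Adjacent p = 0 , diffPrefix-interval p

Adjacent-∷ : ∀ {d n} x {xs ys : Vec ℕ n} → Adjacent d xs ys → Adjacent d (x ∷ xs) (x ∷ ys)
Adjacent-∷ {d} {n} x {xs} {ys} (a , b , b≤a+d , tail-diff) = suc a , suc b , s≤s b≤a+d , diff
  where
  diff : (i : Fin (suc n)) → (lookup (x ∷ xs) i ≢ lookup (x ∷ ys) i) ⇔ (suc a ≤ toℕ i × toℕ i < suc b)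
  diff fzero    = mk⇔ (λ ne → ⊥-elim (ne refl)) (λ { (() , _) })
  diff (fsuc i) = mk⇔ (λ ne → let (a≤i , i<b) = Equivalence.to (tail-diff i) ne in s≤s a≤i , s≤s i<b)
                      (λ { (s≤s a≤i , s≤s i<b) → Equivalence.from (tail-diff i) (a≤i , i<b) })

zeros : (n : ℕ) → Vec ℕ n
zeros zero    = []
zeros (suc n) = 0 ∷ zeros n

zeros-valid : ∀ m n → RGFTail m (zeros n)
zeros-valid m zero    = tt
zeros-valid m (suc n) = z≤n , zeros-valid (m ⊔ 0) n

-- Short M v : v is 0…0, (M+1)0…0 or (M+1)(M+2)0…0; every extremal tail after a
-- prefix with maximum M has this shape.
data Short (M : ℕ) : {n : ℕ} → Vec ℕ n → Set where
  none : ∀ {n} → Short M (zeros n)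
  one  : ∀ {n} → Short M (suc M ∷ zeros n)
  two  : ∀ {n} → Short M (suc M ∷ suc (suc M) ∷ zeros n)

zeros-vs-short : ∀ {M n} {v : Vec ℕ n} → Short M v → DiffPrefix 2 (zeros n) v
zeros-vs-short none = agree
zeros-vs-short one  = differ (λ ()) agree
zeros-vs-short two  = differ (λ ()) (differ (λ ()) agree)

short-distinct : ∀ {M M' n} {u v : Vec ℕ n} → M ≢ M' → Short M u → Short M' v → DiffPrefix 2 u v
short-distinct _    none v    = zeros-vs-short v
short-distinct _    u    none = DiffPrefix-sym (zeros-vs-short u)
short-distinct M≢M' one  one  = differ (M≢M' ∘ suc-injective) agree
short-distinct M≢M' one  two  = differ (M≢M' ∘ suc-injective) (differ (λ ()) agree)
short-distinct M≢M' two  one  = differ (M≢M' ∘ suc-injective) (differ (λ ()) agree)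
short-distinct M≢M' two  two  =
  differ (M≢M' ∘ suc-injective) (differ (M≢M' ∘ suc-injective ∘ suc-injective) agree)

HeadBefore : ℕ → ℕ → ℕ → Set
HeadBefore a x y = (a % 2 ≡ 0 × x < y) ⊎ (a % 2 ≡ 1 × y < x)

HeadBefore⇒≢ : ∀ {a x y} → HeadBefore a x y → x ≢ y
HeadBefore⇒≢ (inj₁ (_ , x<y)) = <⇒≢ x<y
HeadBefore⇒≢ (inj₂ (_ , y<x)) = >⇒≢ y<x

HeadBefore-trans : ∀ {a x y z} → HeadBefore a x y → HeadBefore a y z → HeadBefore a x z
HeadBefore-trans (inj₁ (a0 , x<y)) (inj₁ (_ , y<z))  = inj₁ (a0 , <-trans x<y y<z)
HeadBefore-trans (inj₂ (a1 , y<x)) (inj₂ (_ , z<y))  = inj₂ (a1 , <-trans z<y y<x)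
HeadBefore-trans (inj₁ (a0 , _))   (inj₂ (a1 , _))   = ⊥-elim (0≢1+n (trans (sym a0) a1))
HeadBefore-trans (inj₂ (a1 , _))   (inj₁ (a0 , _))   = ⊥-elim (0≢1+n (trans (sym a0) a1))

head-gap : ∀ {a m x y} → HeadBefore a x y → x ≤ suc m → y ≤ suc m →
           (Σ ℕ λ w → w ≤ suc m × HeadBefore a x w × HeadBefore a w y) ⊎ (y ≡ suc x ⊎ x ≡ suc y)
head-gap {x = x} (inj₁ (a0 , x<y)) _ y≤ with m≤n⇒m<n∨m≡n x<y
... | inj₁ sx<y = inj₁ (suc x , ≤-trans (<⇒≤ sx<y) y≤ , inj₁ (a0 , n<1+n x) , inj₁ (a0 , sx<y))
... | inj₂ sx≡y = inj₂ (inj₁ (sym sx≡y))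
head-gap {y = y} (inj₂ (a1 , y<x)) x≤ _ with m≤n⇒m<n∨m≡n y<x
... | inj₁ sy<x = inj₁ (suc y , ≤-trans (<⇒≤ sy<x) x≤ , inj₂ (a1 , sy<x) , inj₂ (a1 , n<1+n y))
... | inj₂ sy≡x = inj₂ (inj₂ (sym sy≡x))

-- In a strictly increasing listing of all elements satisfying P, two
-- consecutive entries have no P-element between them; hence if every such
-- "gapless" pair is Close, the listing is linked by Close.
module Listing {A : Set} {_⊏_ : A → A → Set}
               (⊏-trans : Transitive _⊏_) (⊏-irrefl : ∀ x → ¬ x ⊏ x) where

  consecutive-close : ∀ {P : A → Set} {Close : A → A → Set} →
    (∀ {s t} → P s → P t → s ⊏ t → (Σ A λ u → P u × s ⊏ u × u ⊏ t) ⊎ Close s t) →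
    (L : List A) → (∀ s → s ∈ L ⇔ P s) → Linked _⊏_ L → Linked Close L
  consecutive-close {P} {Close} gap-or-close L mem sorted =
    go L (λ u pu → inj₁ (Equivalence.from (mem u) pu))
         (All.tabulate (λ {s} s∈L → Equivalence.to (mem s) s∈L))
         (Linked⇒AllPairs ⊏-trans sorted)
    where
    -- Invariant: every P-element is in the remaining list or before all of it.
    go : (L : List A) → (∀ u → P u → u ∈ L ⊎ All (u ⊏_) L) → All P L →
         AllPairs _⊏_ L → Linked Close L
    go []              _   _                  _ = []
    go (s ∷ [])        _   _                  _ = [-]
    go (s ∷ t ∷ rest) inv (ps ∷ pt ∷ prest) ((s⊏t ∷ s⊏rest) ∷ t⊏rest ∷ pairs) =
      close-st ∷ go (t ∷ rest) inv′ (pt ∷ prest) (t⊏rest ∷ pairs)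
      where
      inv′ : ∀ u → P u → u ∈ (t ∷ rest) ⊎ All (u ⊏_) (t ∷ rest)
      inv′ u pu with inv u pu
      ... | inj₁ (here refl) = inj₂ (s⊏t ∷ s⊏rest)
      ... | inj₁ (there u∈) = inj₁ u∈
      ... | inj₂ (_ ∷ u⊏)   = inj₂ u⊏
      close-st : Close s t
      close-st with gap-or-close ps pt s⊏t
      ... | inj₂ close = close
      ... | inj₁ (u , pu , s⊏u , u⊏t) with inv u pu
      ...   | inj₁ (here refl)          = ⊥-elim (⊏-irrefl s s⊏u)
      ...   | inj₁ (there (here refl))  = ⊥-elim (⊏-irrefl t u⊏t)
      ...   | inj₁ (there (there u∈))   = ⊥-elim (⊏-irrefl u (⊏-trans u⊏t (All.lookup t⊏rest u∈)))
      ...   | inj₂ (u⊏s ∷ _)            = ⊥-elim (⊏-irrefl u (⊏-trans u⊏s s⊏u))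

module ReflectedOrder (step : ℕ → ℕ → ℕ) where

  Before : ℕ → {n : ℕ} → Vec ℕ n → Vec ℕ n → Set
  Before = ReflLex step

  before-head : ∀ {a n x y} {xs ys : Vec ℕ n} → HeadBefore a x y → Before a (x ∷ xs) (y ∷ ys)
  before-head {a} h = inj₂ (HeadBefore⇒≢ {a} h , h)

  before-tail : ∀ {a n x} {xs ys : Vec ℕ n} → Before (step a x) xs ys → Before a (x ∷ xs) (x ∷ ys)
  before-tail r = inj₁ (refl , r)

  before-irrefl : ∀ a {n} (xs : Vec ℕ n) → ¬ Before a xs xs
  before-irrefl a []       ()
  before-irrefl a (x ∷ xs) (inj₁ (_ , r))    = before-irrefl (step a x) xs r
  before-irrefl a (x ∷ xs) (inj₂ (x≢x , _)) = x≢x refl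

  before-trans : ∀ a {n} {xs ys zs : Vec ℕ n} → Before a xs ys → Before a ys zs → Before a xs zs
  before-trans a {xs = []} {[]} {[]} () _
  before-trans a {xs = _ ∷ _} {_ ∷ _} {_ ∷ _} (inj₁ (refl , r)) (inj₁ (refl , r′)) =
    before-tail (before-trans _ r r′)
  before-trans a {xs = _ ∷ _} {_ ∷ _} {_ ∷ _} (inj₁ (refl , _)) (inj₂ h) = inj₂ h
  before-trans a {xs = _ ∷ _} {_ ∷ _} {_ ∷ _} (inj₂ h) (inj₁ (refl , _)) = inj₂ h
  before-trans a {xs = _ ∷ _} {_ ∷ _} {_ ∷ _} (inj₂ (_ , h)) (inj₂ (_ , h′)) =
    before-head (HeadBefore-trans {a} h h′)

  Later : ℕ → ℕ → {n : ℕ} → Vec ℕ n → Set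
  Later a m {n} xs = Σ (Vec ℕ n) λ zs → RGFTail m zs × Before a xs zs

  Earlier : ℕ → ℕ → {n : ℕ} → Vec ℕ n → Set
  Earlier a m {n} ys = Σ (Vec ℕ n) λ zs → RGFTail m zs × Before a zs ys

  Between : ℕ → ℕ → {n : ℕ} → Vec ℕ n → Vec ℕ n → Set
  Between a m {n} xs ys = Σ (Vec ℕ n) λ zs → RGFTail m zs × Before a xs zs × Before a zs ys

  Later-∷ : ∀ {a m n x} {xs : Vec ℕ n} → x ≤ suc m → Later (step a x) (m ⊔ x) xs → Later a m (x ∷ xs)
  Later-∷ {x = x} x≤ (zs , vz , r) = x ∷ zs , (x≤ , vz) , before-tail r

  Earlier-∷ : ∀ {a m n y} {ys : Vec ℕ n} → y ≤ suc m → Earlier (step a y) (m ⊔ y) ys → Earlier a m (y ∷ ys)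
  Earlier-∷ {y = y} y≤ (zs , vz , r) = y ∷ zs , (y≤ , vz) , before-tail r

  Between-∷ : ∀ {a m n x} {xs ys : Vec ℕ n} → x ≤ suc m →
              Between (step a x) (m ⊔ x) xs ys → Between a m (x ∷ xs) (x ∷ ys)
  Between-∷ {x = x} x≤ (zs , vz , r₁ , r₂) = x ∷ zs , (x≤ , vz) , before-tail r₁ , before-tail r₂

  maxTail minTail : ℕ → ℕ → (n : ℕ) → Vec ℕ n
  maxTail a m zero    = []
  maxTail a m (suc n) = byParity a (suc m ∷ maxTail (step a (suc m)) (m ⊔ suc m) n)
                                   (0     ∷ maxTail (step a 0)       (m ⊔ 0)     n)
  minTail a m zero    = []
  minTail a m (suc n) = byParity a (0     ∷ minTail (step a 0)       (m ⊔ 0)     n)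
                                   (suc m ∷ minTail (step a (suc m)) (m ⊔ suc m) n)

  maxTail-or-Later : ∀ a m {n} (xs : Vec ℕ n) → RGFTail m xs → xs ≡ maxTail a m n ⊎ Later a m xs
  maxTail-or-Later a m []       _         = inj₁ refl
  maxTail-or-Later a m (x ∷ xs) (x≤ , vx) with parity a
  maxTail-or-Later a m (x ∷ xs) (x≤ , vx) | inj₁ a0 with m≤n⇒m<n∨m≡n x≤
  ... | inj₁ x<sm =
    inj₂ (suc m ∷ zeros _ , (≤-refl , zeros-valid _ _) , before-head (inj₁ (a0 , x<sm)))
  ... | inj₂ refl =
    Sum.map (λ eq → trans (cong (suc m ∷_) eq) (sym (byParity-even a a0))) (Later-∷ x≤)
            (maxTail-or-Later (step a (suc m)) (m ⊔ suc m) xs vx)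
  maxTail-or-Later a m (suc x ∷ xs) _ | inj₂ a1 =
    inj₂ (0 ∷ zeros _ , (z≤n , zeros-valid _ _) , before-head (inj₂ (a1 , s≤s z≤n)))
  maxTail-or-Later a m (zero ∷ xs) (x≤ , vx) | inj₂ a1 =
    Sum.map (λ eq → trans (cong (0 ∷_) eq) (sym (byParity-odd a a1))) (Later-∷ x≤)
            (maxTail-or-Later (step a 0) (m ⊔ 0) xs vx)

  minTail-or-Earlier : ∀ a m {n} (ys : Vec ℕ n) → RGFTail m ys → ys ≡ minTail a m n ⊎ Earlier a m ys
  minTail-or-Earlier a m []       _         = inj₁ refl
  minTail-or-Earlier a m (y ∷ ys) (y≤ , vy) with parity a
  minTail-or-Earlier a m (y ∷ ys) (y≤ , vy) | inj₂ a1 with m≤n⇒m<n∨m≡n y≤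
  ... | inj₁ y<sm =
    inj₂ (suc m ∷ zeros _ , (≤-refl , zeros-valid _ _) , before-head (inj₂ (a1 , y<sm)))
  ... | inj₂ refl =
    Sum.map (λ eq → trans (cong (suc m ∷_) eq) (sym (byParity-odd a a1))) (Earlier-∷ y≤)
            (minTail-or-Earlier (step a (suc m)) (m ⊔ suc m) ys vy)
  minTail-or-Earlier a m (suc y ∷ ys) _ | inj₁ a0 =
    inj₂ (0 ∷ zeros _ , (z≤n , zeros-valid _ _) , before-head (inj₁ (a0 , s≤s z≤n)))
  minTail-or-Earlier a m (zero ∷ ys) (y≤ , vy) | inj₁ a0 =
    Sum.map (λ eq → trans (cong (0 ∷_) eq) (sym (byParity-even a a0))) (Earlier-∷ y≤)
            (minTail-or-Earlier (step a 0) (m ⊔ 0) ys vy)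

  module Adjacency (step-shift : ∀ b y → step b y ≡ b + step 0 y)
                   (step-0-0 : step 0 0 ≡ 0)
                   (odd-increment : ∀ K → step 0 (suc K) % 2 ≡ 1 ⊎ step 0 (suc (suc K)) % 2 ≡ 1)
                   where

    step-zero : ∀ b → step b 0 ≡ b
    step-zero b = trans (step-shift b 0) (trans (cong (b +_) step-0-0) (+-identityʳ b))

    step-opposite : ∀ b c y → b % 2 ≢ c % 2 → step b y % 2 ≢ step c y % 2
    step-opposite b c y b≢c eq = b≢c (%2-+-cancelˡ b c (step 0 y) (begin
      (b + step 0 y) % 2  ≡⟨ cong (_% 2) (sym (step-shift b y)) ⟩
      step b y % 2        ≡⟨ eq ⟩
      step c y % 2        ≡⟨ cong (_% 2) (step-shift c y) ⟩
      (c + step 0 y) % 2  ∎))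

    step-flips : ∀ b {y} → step 0 y % 2 ≡ 1 → step b y % 2 ≢ b % 2
    step-flips b {y} odd = odd-+-flips b odd ∘ trans (cong (_% 2) (sym (step-shift b y)))

    second-flips : ∀ b K → step b (suc K) % 2 ≡ b % 2 →
                   step (step b (suc K)) (suc (suc K)) % 2 ≢ step b (suc K) % 2
    second-flips b K keeps with odd-increment K
    ... | inj₁ odd₁ = ⊥-elim (step-flips b odd₁ keeps)
    ... | inj₂ odd₂ = step-flips (step b (suc K)) odd₂

    maxTail-odd : ∀ b M n → b % 2 ≡ 1 → maxTail b M n ≡ zeros n
    maxTail-odd b M zero    _  = refl
    maxTail-odd b M (suc n) b1 = begin
      maxTail b M (suc n)                ≡⟨ byParity-odd b b1 ⟩
      0 ∷ maxTail (step b 0) (M ⊔ 0) n  ≡⟨ cong (0 ∷_) (maxTail-odd _ _ n b0-odd) ⟩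
      0 ∷ zeros n                        ∎
      where
      b0-odd : step b 0 % 2 ≡ 1
      b0-odd = trans (cong (_% 2) (step-zero b)) b1

    max≡min : ∀ b c M n → b % 2 ≢ c % 2 → maxTail b M n ≡ minTail c M n
    max≡min b c M zero _ = refl
    max≡min b c M (suc n) b≢c with opposite-parity b c b≢c
    ... | inj₁ (b0 , c1) = begin
      maxTail b M (suc n)                                  ≡⟨ byParity-even b b0 ⟩
      suc M ∷ maxTail (step b (suc M)) (M ⊔ suc M) n      ≡⟨ cong (suc M ∷_) tail-eq ⟩
      suc M ∷ minTail (step c (suc M)) (M ⊔ suc M) n      ≡⟨ sym (byParity-odd c c1) ⟩
      minTail c M (suc n)                                  ∎
      where
      tail-eq : maxTail (step b (suc M)) (M ⊔ suc M) n ≡ minTail (step c (suc M)) (M ⊔ suc M) n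
      tail-eq = max≡min _ _ _ n (step-opposite b c (suc M) b≢c)
    ... | inj₂ (b1 , c0) = begin
      maxTail b M (suc n)                      ≡⟨ byParity-odd b b1 ⟩
      0 ∷ maxTail (step b 0) (M ⊔ 0) n        ≡⟨ cong (0 ∷_) (max≡min _ _ _ n (step-opposite b c 0 b≢c)) ⟩
      0 ∷ minTail (step c 0) (M ⊔ 0) n        ≡⟨ sym (byParity-even c c0) ⟩
      minTail c M (suc n)                      ∎

    maxTail-parity : ∀ b c M n → b % 2 ≡ c % 2 → maxTail b M n ≡ maxTail c M n
    maxTail-parity b c M n b≡c = begin
      maxTail b M n        ≡⟨ max≡min b (suc c) M n (λ b≡sc → suc-flips c (trans (sym b≡sc) b≡c)) ⟩
      minTail (suc c) M n  ≡⟨ sym (max≡min c (suc c) M n (suc-flips c ∘ sym)) ⟩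
      maxTail c M n        ∎

    maxTail-short-even : ∀ b M n → b % 2 ≡ 0 → Short M (suc M ∷ maxTail (step b (suc M)) (suc M) n)
    maxTail-short-even b M zero    _  = one
    maxTail-short-even b M (suc n) b0 with parity (step b (suc M))
    ... | inj₂ b₁-odd = subst (λ v → Short M (suc M ∷ v)) (sym (maxTail-odd _ _ (suc n) b₁-odd)) one
    ... | inj₁ b₁-even = subst (λ v → Short M (suc M ∷ v)) (sym tail-eq) two
      where
      b₁ b₂ : ℕ
      b₁ = step b (suc M)
      b₂ = step b₁ (suc (suc M))
      b₂-odd : b₂ % 2 ≡ 1
      b₂-odd with opposite-parity b₂ b₁ (second-flips b M (trans b₁-even (sym b0)))
      ... | inj₁ (_ , b₁-odd) = ⊥-elim (0≢1+n (trans (sym b₁-even) b₁-odd))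
      ... | inj₂ (b₂-odd , _) = b₂-odd
      tail-eq : maxTail b₁ (suc M) (suc n) ≡ suc (suc M) ∷ zeros n
      tail-eq = begin
        maxTail b₁ (suc M) (suc n)                             ≡⟨ byParity-even b₁ b₁-even ⟩
        suc (suc M) ∷ maxTail b₂ (suc M ⊔ suc (suc M)) n      ≡⟨ cong (suc (suc M) ∷_) (maxTail-odd _ _ n b₂-odd) ⟩
        suc (suc M) ∷ zeros n                                  ∎

    maxTail-short : ∀ b M n → Short M (maxTail b M n)
    maxTail-short b M zero = none
    maxTail-short b M (suc n) with parity b
    ... | inj₂ b1 = subst (Short M) (sym (maxTail-odd b M (suc n) b1)) none
    ... | inj₁ b0 = subst (Short M) (sym unfold) (maxTail-short-even b M n b0)
      where
      unfold : maxTail b M (suc n) ≡ suc M ∷ maxTail (step b (suc M)) (suc M) n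
      unfold = begin
        maxTail b M (suc n)                              ≡⟨ byParity-even b b0 ⟩
        suc M ∷ maxTail (step b (suc M)) (M ⊔ suc M) n  ≡⟨ cong (λ k → suc M ∷ maxTail (step b (suc M)) k n)
                                                               (m≤n⇒m⊔n≡n (n≤1+n M)) ⟩
        suc M ∷ maxTail (step b (suc M)) (suc M) n      ∎

    maxTails-close : ∀ b c M M′ n → DiffPrefix 2 (maxTail b M n) (maxTail c M′ n)
    maxTails-close b c M M′ n with M ≟ M′
    ... | no M≢M′ = short-distinct M≢M′ (maxTail-short b M n) (maxTail-short c M′ n)
    ... | yes refl with b % 2 ≟ c % 2
    ...   | yes b≡c = subst (DiffPrefix 2 (maxTail b M n)) (maxTail-parity b c M n b≡c) agree
    ...   | no b≢c with opposite-parity b c b≢c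
    ...     | inj₂ (b1 , _) = subst (λ u → DiffPrefix 2 u (maxTail c M n)) (sym (maxTail-odd b M n b1))
                                     (zeros-vs-short (maxTail-short c M n))
    ...     | inj₁ (_ , c1) = subst (DiffPrefix 2 (maxTail b M n)) (sym (maxTail-odd c M n c1))
                                     (DiffPrefix-sym (zeros-vs-short (maxTail-short b M n)))

    max-min-close : ∀ b c M M′ n → DiffPrefix 2 (maxTail b M n) (minTail c M′ n)
    max-min-close b c M M′ n =
      subst (DiffPrefix 2 (maxTail b M n)) (max≡min (suc c) c M′ n (suc-flips c))
            (maxTails-close b (suc c) M M′ n)

    extremal-or-between : ∀ {a m n x y} {xs ys : Vec ℕ n} → HeadBefore a x y →
      x ≤ suc m → y ≤ suc m → RGFTail (m ⊔ x) xs → RGFTail (m ⊔ y) ys →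
      Between a m (x ∷ xs) (y ∷ ys) ⊎ Adjacent 3 (x ∷ xs) (y ∷ ys)
    extremal-or-between {a} {m} {n} {x} {y} {xs} {ys} hd x≤ y≤ vx vy
      with maxTail-or-Later (step a x) (m ⊔ x) xs vx | minTail-or-Earlier (step a y) (m ⊔ y) ys vy
    ... | inj₂ (zs , vz , r) | _ = inj₁ (x ∷ zs , (x≤ , vz) , before-tail r , before-head hd)
    ... | inj₁ _ | inj₂ (zs , vz , r) = inj₁ (y ∷ zs , (y≤ , vz) , before-head hd , before-tail r)
    ... | inj₁ refl | inj₁ refl =
      inj₂ (DiffPrefix⇒Adjacent (differ (HeadBefore⇒≢ {a} hd) (max-min-close _ _ _ _ n)))

    gap-or-adjacent : ∀ a m {n} (xs ys : Vec ℕ n) → RGFTail m xs → RGFTail m ys → Before a xs ys →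
                      Between a m xs ys ⊎ Adjacent 3 xs ys
    gap-or-adjacent a m []       []        _         _         ()
    gap-or-adjacent a m (x ∷ xs) (.x ∷ ys) (x≤ , vx) (_ , vy)  (inj₁ (refl , r)) =
      Sum.map (Between-∷ x≤) (Adjacent-∷ x) (gap-or-adjacent (step a x) (m ⊔ x) xs ys vx vy r)
    gap-or-adjacent a m (x ∷ xs) (y ∷ ys)  (x≤ , vx) (y≤ , vy) (inj₂ (_ , hd)) with head-gap {a} hd x≤ y≤
    ... | inj₁ (w , w≤ , xw , wy) =
      inj₁ (w ∷ zeros _ , (w≤ , zeros-valid _ _) , before-head xw , before-head wy)
    ... | inj₂ _ = extremal-or-between hd x≤ y≤ vx vy

    rgf-gap-or-adjacent : ∀ {n} {s t : Vec ℕ n} → IsRGF s → IsRGF t → Before 0 s t →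
      (Σ (Vec ℕ n) λ u → IsRGF u × Before 0 s u × Before 0 u t) ⊎ Adjacent 3 s t
    rgf-gap-or-adjacent {s = []} {[]} _ _ ()
    rgf-gap-or-adjacent {s = _ ∷ xs} {_ ∷ ys} (refl , vx) (refl , vy) (inj₁ (_ , r)) =
      Sum.map (λ (zs , vz , r₁ , r₂) → 0 ∷ zs , (refl , vz) , before-tail r₁ , before-tail r₂)
              (Adjacent-∷ 0) (gap-or-adjacent (step 0 0) 0 xs ys vx vy r)
    rgf-gap-or-adjacent {s = _ ∷ _} {_ ∷ _} (refl , _) (refl , _) (inj₂ (0≢0 , _)) = ⊥-elim (0≢0 refl)

    listing-adjacent : ∀ {n} (L : List (Vec ℕ n)) → IsListingOfRGF (Before 0) L → IsAdjGray 3 L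
    listing-adjacent L (mem , sorted) =
      Listing.consecutive-close (before-trans 0) (before-irrefl 0) rgf-gap-or-adjacent L mem sorted

sum-odd-increment : ∀ K → sumStep 0 (suc K) % 2 ≡ 1 ⊎ sumStep 0 (suc (suc K)) % 2 ≡ 1
sum-odd-increment zero          = inj₁ refl
sum-odd-increment (suc zero)    = inj₂ refl
sum-odd-increment (suc (suc K)) = sum-odd-increment K

nzEvenStep-shift : ∀ b y → nzEvenStep b y ≡ b + nzEvenStep 0 y
nzEvenStep-shift b zero = sym (+-identityʳ b)
nzEvenStep-shift b (suc y) with suc y % 2
... | zero  = sym (+-comm b 1)
... | suc _ = sym (+-identityʳ b)

-- Of two consecutive positive entries one is even, i.e. increments U_k.
nz-odd-increment : ∀ K → nzEvenStep 0 (suc K) % 2 ≡ 1 ⊎ nzEvenStep 0 (suc (suc K)) % 2 ≡ 1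
nz-odd-increment zero          = inj₂ refl
nz-odd-increment (suc zero)    = inj₁ refl
nz-odd-increment (suc (suc K)) = nz-odd-increment K

module ReflectedGray = ReflectedOrder.Adjacency sumStep (λ _ _ → refl) refl sum-odd-increment
module CoReflectedGray = ReflectedOrder.Adjacency nzEvenStep nzEvenStep-shift refl nz-odd-increment

corollary1 : (n : ℕ) → n ≥ 1 →
    ((L : List (Vec ℕ n)) → IsListingOfRGF _≺_ L → IsAdjGray 3 L)
    × ((L : List (Vec ℕ n)) → IsListingOfRGF _⋖_ L → IsAdjGray 3 L)
corollary1 n _ = ReflectedGray.listing-adjacent , CoReflectedGray.listing-adjacent
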